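{- For integers $\nu\ge1$ and $n\ge0$, \[ \sum_{\tau=0}^{\infty}(-1)^\tau p\!\left(n-\frac{(\nu+\tau)(\nu+\tau-1)}{2}\right)\ge0, \] where $p(x)=0$ if $x$ is a negative integer.
   Context: $p(n)$ is the number of partitions of $n$. -}

module Defs where

open import Data.Nat using (ℕ; zero; suc; _+_; _*_; _∸_; _≤?_)
open import Data.Nat.DivMod using (_/_)
open import Data.List using (List; []; _∷_; [_]; _++_; map; length; sum)
open import Data.Integer as ℤ using (ℤ; +_; -[1+_])
open import Relation.Nullary using (yes; no)

-- Partitions of n with all parts ≤ k, each written as a non-increasing
-- list of positive parts.  The first argument is fuel (structural
-- recursion); it is always ≥ n in uses below, so it never runs out.
--   parts ≤ 0 of 0     : the empty partition only
--   parts ≤ 0 of n+1   : none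
--   parts ≤ k+1 of n   : (parts ≤ k of n) ++ (k+1 ∷ parts ≤ k+1 of n-(k+1)) if k+1 ≤ n
boundedPartitions : (fuel k n : ℕ) → List (List ℕ)
boundedPartitions _          zero    zero    = [ [] ]
boundedPartitions _          zero    (suc n) = []
boundedPartitions zero       (suc k) n       = []
boundedPartitions (suc fuel) (suc k) n with suc k ≤? n
... | yes _ = boundedPartitions (suc fuel) k n
           ++ map (suc k ∷_) (boundedPartitions fuel (suc k) (n ∸ suc k))
... | no  _ = boundedPartitions (suc fuel) k n

partitions : ℕ → List (List ℕ)
partitions n = boundedPartitions (suc n) n n

p : ℕ → ℕ
p n = length (partitions n)

pℤ : ℤ → ℤ
pℤ (+ n)      = + p n
pℤ -[1+ _ ]   = + 0

tri : ℕ → ℕ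
tri m = (m * (m ∸ 1)) / 2

term : (ν n τ : ℕ) → ℤ
term ν n τ = sign τ ℤ.* pℤ (+ n ℤ.- + tri (ν + τ))
  where
  sign : ℕ → ℤ
  sign zero          = + 1
  sign (suc zero)    = ℤ.- + 1
  sign (suc (suc t)) = sign t

partialSum : (ν n N : ℕ) → ℤ
partialSum ν n zero    = + 0
partialSum ν n (suc N) = partialSum ν n N ℤ.+ term ν n N

{-# OPTIONS --safe #-}
module Submission where

-- p is nondecreasing (from the recurrence p_k(n) = p_{k-1}(n) + p_k(n-k) for partitions into
-- parts ≤ k), so, as the triangular numbers increase, τ ↦ p(n − (ν+τ)(ν+τ−1)/2) is a
-- nonincreasing sequence of nonnegative integers.  Every partial sum of an alternating series
-- with such terms lies between 0 and its first term: peeling off the first term leaves a₀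
-- minus a partial sum of the same kind for a₁, a₂, …

open import Defs
open import Data.Nat as ℕ using (ℕ; _≤_; _<_; zero; suc; _+_; _∸_; _≤?_; z≤n; z<s; s≤s; s≤s⁻¹)
open import Data.Nat.Properties
  using (≤-refl; ≤-reflexive; ≤-trans; <-≤-trans; m≤m+n; n≤1+n; +-mono-≤; *-mono-≤;
         ∸-monoˡ-≤; ∸-monoʳ-<; +-monoʳ-≤; +-suc; +-∸-assoc; m≤n⇒m≤1+n; m≤n⇒m<n∨m≡n; module ≤-Reasoning)
open import Data.Nat.DivMod using (/-monoˡ-≤)
open import Data.Integer as ℤ using (ℤ; +_; -[1+_]; 0ℤ; -1ℤ; _-_; _^_; +≤+)
  renaming (_≤_ to _≤ℤ_)
open import Data.Integer.Properties using (i≤j⇒0≤j-i; i-j≤i; neg-mono-≤)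
  renaming (≤-refl to ≤ℤ-refl; ≤-trans to ≤ℤ-trans; +-monoʳ-≤ to +ℤ-monoʳ-≤)
open import Data.Integer.Tactic.RingSolver using (solve-∀)
open import Data.List using (_∷_; length)
open import Data.List.Properties using (length-++; length-map)
open import Data.Product using (_×_; _,_; proj₁)
open import Data.Sum using (inj₁; inj₂)
open import Function using (_∘_; case_of_)
open import Relation.Nullary using (¬_; yes; no; contradiction)
open import Relation.Binary.PropositionalEquality using (_≡_; refl; cong; cong₂; sym; trans; subst; module ≡-Reasoning)

countBounded : (fuel k n : ℕ) → ℕ
countBounded fuel k n = length (boundedPartitions fuel k n)

countBounded-split : ∀ f k n → suc k ≤ n →
  countBounded (suc f) (suc k) n ≡ countBounded (suc f) k n + countBounded f (suc k) (n ∸ suc k)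
countBounded-split f k n k<n with suc k ≤? n
... | yes _ = trans (length-++ (boundedPartitions (suc f) k n))
  (cong (countBounded (suc f) k n ℕ.+_) (length-map (suc k ∷_) (boundedPartitions f (suc k) (n ∸ suc k))))
... | no k≮n = contradiction k<n k≮n

countBounded-skip : ∀ f k n → ¬ suc k ≤ n → countBounded (suc f) (suc k) n ≡ countBounded (suc f) k n
countBounded-skip f k n k≮n with suc k ≤? n
... | yes k<n = contradiction k<n k≮n
... | no _ = refl

countBounded-one : ∀ f n → n < f → countBounded f 1 n ≡ 1
countBounded-one (suc f) zero    _         = countBounded-skip f 0 0 λ ()
countBounded-one (suc f) (suc n) (s≤s n<f) =
  trans (countBounded-split f 0 (suc n) (s≤s z≤n)) (countBounded-one f n n<f)

countBounded-monoᵏ : ∀ f k n → countBounded (suc f) k n ≤ countBounded (suc f) (suc k) n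
countBounded-monoᵏ f k n = case suc k ≤? n of λ where
  (yes k<n) → ≤-trans (m≤m+n _ _) (≤-reflexive (sym (countBounded-split f k n k<n)))
  (no  k≮n) → ≤-reflexive (sym (countBounded-skip f k n k≮n))

countBounded-monoⁿ : ∀ f k n → n < f → countBounded f (suc k) n ≤ countBounded (suc f) (suc k) (suc n)
countBounded-monoⁿ f       zero    n n<f =
  ≤-reflexive (trans (countBounded-one f n n<f) (sym (countBounded-one (suc f) (suc n) (s≤s n<f))))
countBounded-monoⁿ (suc f) (suc k) n n<f =
  case suc (suc k) ≤? n of λ { (yes 2+k≤n) → part-fits 2+k≤n ; (no 2+k≰n) → part-too-large 2+k≰n }
  where
  open ≤-Reasoning

  part-fits : suc (suc k) ≤ n →
    countBounded (suc f) (suc (suc k)) n ≤ countBounded (suc (suc f)) (suc (suc k)) (suc n)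
  part-fits 2+k≤n = begin
    countBounded (suc f) (suc (suc k)) n
      ≡⟨ countBounded-split f (suc k) n 2+k≤n ⟩
    countBounded (suc f) (suc k) n + countBounded f (suc (suc k)) m
      ≤⟨ +-mono-≤ (countBounded-monoⁿ (suc f) k n n<f) (countBounded-monoⁿ f (suc k) m m<f) ⟩
    countBounded (suc (suc f)) (suc k) (suc n) + countBounded (suc f) (suc (suc k)) (suc m)
      ≡⟨ cong (λ j → countBounded (suc (suc f)) (suc k) (suc n) + countBounded (suc f) (suc (suc k)) j)
              (sym (+-∸-assoc 1 2+k≤n)) ⟩
    countBounded (suc (suc f)) (suc k) (suc n) + countBounded (suc f) (suc (suc k)) (suc n ∸ suc (suc k))
      ≡⟨ countBounded-split (suc f) (suc k) (suc n) (m≤n⇒m≤1+n 2+k≤n) ⟨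
    countBounded (suc (suc f)) (suc (suc k)) (suc n) ∎
    where
    m = n ∸ suc (suc k)
    m<f : m < f
    m<f = <-≤-trans (∸-monoʳ-< z<s 2+k≤n) (s≤s⁻¹ n<f)

  part-too-large : ¬ suc (suc k) ≤ n →
    countBounded (suc f) (suc (suc k)) n ≤ countBounded (suc (suc f)) (suc (suc k)) (suc n)
  part-too-large 2+k≰n = begin
    countBounded (suc f) (suc (suc k)) n       ≡⟨ countBounded-skip f (suc k) n 2+k≰n ⟩
    countBounded (suc f) (suc k) n             ≤⟨ countBounded-monoⁿ (suc f) k n n<f ⟩
    countBounded (suc (suc f)) (suc k) (suc n) ≤⟨ countBounded-monoᵏ (suc f) (suc k) (suc n) ⟩
    countBounded (suc (suc f)) (suc (suc k)) (suc n) ∎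

p-suc : ∀ n → p n ≤ p (suc n)
p-suc n = ≤-trans (countBounded-monoᵏ n n n) (countBounded-monoⁿ (suc n) n n ≤-refl)

p-mono : ∀ {m n} → m ≤ n → p m ≤ p n
p-mono {n = zero}  z≤n = ≤-refl
p-mono {n = suc n} m≤1+n with m≤n⇒m<n∨m≡n m≤1+n
... | inj₁ (s≤s m≤n) = ≤-trans (p-mono m≤n) (p-suc n)
... | inj₂ refl      = ≤-refl

alternatingSum : (ℕ → ℤ) → ℕ → ℤ
alternatingSum a zero    = 0ℤ
alternatingSum a (suc N) = alternatingSum a N ℤ.+ -1ℤ ^ N ℤ.* a N

alternatingSum-peel : ∀ a N → alternatingSum a (suc N) ≡ a 0 - alternatingSum (a ∘ suc) N
alternatingSum-peel a zero    = 0+1*x≡x-0 (a 0)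
  where
  0+1*x≡x-0 : ∀ x → 0ℤ ℤ.+ -1ℤ ^ 0 ℤ.* x ≡ x - 0ℤ
  0+1*x≡x-0 = solve-∀
alternatingSum-peel a (suc N) = begin
  alternatingSum a (suc N) ℤ.+ -1ℤ ^ suc N ℤ.* a (suc N)
    ≡⟨ cong (ℤ._+ -1ℤ ^ suc N ℤ.* a (suc N)) (alternatingSum-peel a N) ⟩
  (a 0 - alternatingSum (a ∘ suc) N) ℤ.+ -1ℤ ℤ.* -1ℤ ^ N ℤ.* a (suc N)
    ≡⟨ [x-y]-s*z≡x-[y+s*z] (a 0) (alternatingSum (a ∘ suc) N) (-1ℤ ^ N) (a (suc N)) ⟩
  a 0 - alternatingSum (a ∘ suc) (suc N) ∎
  where
  open ≡-Reasoning
  [x-y]-s*z≡x-[y+s*z] : ∀ x y s z → (x - y) ℤ.+ -1ℤ ℤ.* s ℤ.* z ≡ x - (y ℤ.+ s ℤ.* z)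
  [x-y]-s*z≡x-[y+s*z] = solve-∀

alternatingSum-between : ∀ a → (∀ τ → 0ℤ ≤ℤ a τ) → (∀ τ → a (suc τ) ≤ℤ a τ) →
  ∀ N → 0ℤ ≤ℤ alternatingSum a N × alternatingSum a N ≤ℤ a 0
alternatingSum-between a a≥0 a↓ zero    = ≤ℤ-refl , a≥0 0
alternatingSum-between a a≥0 a↓ (suc N)
  rewrite alternatingSum-peel a N
  with alternatingSum-between (a ∘ suc) (a≥0 ∘ suc) (a↓ ∘ suc) N
... | tail≥0 , tail≤a₁ =
  i≤j⇒0≤j-i (≤ℤ-trans tail≤a₁ (a↓ 0)) , i-j≤i (a 0) _ {{ℤ.nonNegative tail≥0}}

pℤ-nonneg : ∀ x → 0ℤ ≤ℤ pℤ x
pℤ-nonneg (+ n)    = +≤+ z≤n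
pℤ-nonneg -[1+ n ] = +≤+ z≤n

pℤ-mono : ∀ {x y} → x ≤ℤ y → pℤ x ≤ℤ pℤ y
pℤ-mono {x = -[1+ _ ]} _ = pℤ-nonneg _
pℤ-mono {x = + _} (+≤+ m≤n) = +≤+ (p-mono m≤n)

tri-mono : ∀ {m n} → m ≤ n → tri m ≤ tri n
tri-mono m≤n = /-monoˡ-≤ 2 (*-mono-≤ m≤n (∸-monoˡ-≤ 1 m≤n))

magnitude : (ν n τ : ℕ) → ℤ
magnitude ν n τ = pℤ (+ n - + tri (ν + τ))

magnitude-antitone : ∀ ν n τ → magnitude ν n (suc τ) ≤ℤ magnitude ν n τ
magnitude-antitone ν n τ =
  pℤ-mono (+ℤ-monoʳ-≤ (+ n) (neg-mono-≤ (+≤+ (tri-mono (+-monoʳ-≤ ν (n≤1+n τ))))))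

magnitude-shift : ∀ ν n t → magnitude (suc (suc ν)) n t ≡ magnitude ν n (suc (suc t))
magnitude-shift ν n t rewrite +-suc ν (suc t) | +-suc ν t = refl

-- The sign in `term` is local to its definition; its period 2 is reached by trading τ + 2 for ν + 2.
term-shift : ∀ ν n t → term ν n (suc (suc t)) ≡ term (suc (suc ν)) n t
term-shift ν n t rewrite +-suc ν (suc t) | +-suc ν t = refl

term-alternating : ∀ ν n τ → term ν n τ ≡ -1ℤ ^ τ ℤ.* magnitude ν n τ
term-alternating ν n zero          = refl
term-alternating ν n (suc zero)    = refl
term-alternating ν n (suc (suc t)) = begin
  term ν n (suc (suc t))                        ≡⟨ term-shift ν n t ⟩
  term (suc (suc ν)) n t                        ≡⟨ term-alternating (suc (suc ν)) n t ⟩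
  -1ℤ ^ t ℤ.* magnitude (suc (suc ν)) n t        ≡⟨ cong (-1ℤ ^ t ℤ.*_) (magnitude-shift ν n t) ⟩
  -1ℤ ^ t ℤ.* magnitude ν n (suc (suc t))        ≡⟨ s*z≡-1*[-1*s]*z (-1ℤ ^ t) _ ⟩
  -1ℤ ^ suc (suc t) ℤ.* magnitude ν n (suc (suc t)) ∎
  where
  open ≡-Reasoning
  s*z≡-1*[-1*s]*z : ∀ s z → s ℤ.* z ≡ -1ℤ ℤ.* (-1ℤ ℤ.* s) ℤ.* z
  s*z≡-1*[-1*s]*z = solve-∀

partialSum-alternating : ∀ ν n N → partialSum ν n N ≡ alternatingSum (magnitude ν n) N
partialSum-alternating ν n zero    = refl
partialSum-alternating ν n (suc N) =
  cong₂ ℤ._+_ (partialSum-alternating ν n N) (term-alternating ν n N)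

corollary1p11 : (ν n : ℕ) → 1 ≤ ν → (N : ℕ) → n < N →
    + 0 ≤ℤ partialSum ν n N
corollary1p11 ν n _ N _ =
  subst (0ℤ ≤ℤ_) (sym (partialSum-alternating ν n N))
    (proj₁ (alternatingSum-between (magnitude ν n) (λ τ → pℤ-nonneg _) (magnitude-antitone ν n) N))
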